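{- For every positive integer $N$ and every admissible index $\boldsymbol{k}=(k_1,\dots,k_r)$, \[ \zeta^{\diamondsuit}_N(\boldsymbol{k})=\sum_{\substack{0<n_{i,1}\le\cdots\le n_{i,k_i}<N\ (i\in[r])\\ n_{i,k_i}\le n_{i+1,1}\ (i\in[r]^1_{\boldsymbol{k}})\\ n_{i,k_i}<n_{i+1,1}\ (i\in[r-1]\setminus[r]^1_{\boldsymbol{k}})}}\ \prod_{i\in[r]}\frac{1}{(N-n_{i,1})\,n_{i,2}\cdots n_{i,k_i}}. \]
   Context: $[n]=\{1,\dots,n\}$. An index $\boldsymbol{k}=(k_1,\dots,k_r)$ of positive integers is admissible if $k_r\ge2$; $[r]^1_{\boldsymbol{k}}=\{i\in[r]\mid k_i=1\}$. For $A\subset[r]^1_{\boldsymbol{k}}$, $S_{r,N}(A)=\{(n_1,\dots,n_r)\in[N-1]^r\mid n_i\le n_{i+1}\ (i\in A),\ n_i<n_{i+1}\ (i\in[r-1]\setminus A)\}$, and \[ \zeta^{\diamondsuit}_N(\boldsymbol{k})=\sum_{A\subset[r]^1_{\boldsymbol{k}}}\sum_{(n_i)\in S_{r,N}(A)}\prod_{i\in A}\frac{1}{N-n_i}\prod_{i\in[r]\setminus A}\frac{1}{n_i^{k_i}}. \] -}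

module Defs where

open import Data.Nat as ℕ using (ℕ; zero; suc; _∸_; _^_; _≤ᵇ_; _<ᵇ_; _≡ᵇ_; _≤_)
open import Data.Integer using (+_)
open import Data.Rational as ℚ using (ℚ; 0ℚ; 1ℚ)
open import Data.Bool using (Bool; true; false; _∧_; if_then_else_)
open import Data.List using (List; []; _∷_; _++_; map; concatMap; foldr; filter; _∷ʳ_)
open import Data.Product using (Σ; _×_)
open import Relation.Binary.PropositionalEquality using (_≡_)
open import Relation.Nullary.Decidable using (yes; no)
open import Data.Bool using (_≟_)

-- reciprocal 1/n of a natural number, as a rational.
-- (Only ever applied to positive arguments below; the value at 0 is irrelevant.)
recip : ℕ → ℚ
recip zero    = 0ℚ
recip (suc n) = (+ 1) ℚ./ suc n

sumℚ : List ℚ → ℚ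
sumℚ = foldr ℚ._+_ 0ℚ

prodℚ : List ℚ → ℚ
prodℚ = foldr ℚ._*_ 1ℚ

-- [N-1] = 1, 2, ..., N-1
range : ℕ → List ℕ
range zero          = []
range (suc zero)    = []
range (suc (suc m)) = range (suc m) ∷ʳ suc m

tuples : ℕ → ℕ → List (List ℕ)
tuples N zero    = [] ∷ []
tuples N (suc m) = concatMap (λ x → map (x ∷_) (tuples N m)) (range N)

Admissible : List ℕ → Set
Admissible k = Σ (List ℕ) λ ks → Σ ℕ λ m → (k ≡ ks ∷ʳ m) × (2 ≤ m)

-- all subsets A ⊂ [r]^1_k, encoded as characteristic Bool lists of length r
subsets1 : List ℕ → List (List Bool)
subsets1 []       = [] ∷ []
subsets1 (k ∷ ks) = map (false ∷_) (subsets1 ks)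
                 ++ (if k ≡ᵇ 1 then map (true ∷_) (subsets1 ks) else [])

inS : List Bool → List ℕ → Bool
inS (a ∷ as@(_ ∷ _)) (n ∷ ns@(n' ∷ _)) =
  (if a then n ≤ᵇ n' else n <ᵇ n') ∧ inS as ns
inS _ _ = true

termS : ℕ → List ℕ → List Bool → List ℕ → ℚ
termS N (k ∷ ks) (a ∷ as) (n ∷ ns) =
  (if a then recip (N ∸ n) else recip (n ^ k)) ℚ.* termS N ks as ns
termS N _ _ _ = 1ℚ

length : List ℕ → ℕ
length []       = 0
length (_ ∷ xs) = suc (length xs)

ζ♢ : ℕ → List ℕ → ℚ
ζ♢ N k = sumℚ (concatMap
  (λ A → map (termS N k A)
     (filter (λ n → inS A n ≟ true) (tuples N (length k))))
  (subsets1 k))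

-- right-hand side: families (n_{i,j}) given as a list of blocks,
-- block i = (n_{i,1},...,n_{i,k_i})

blocks : ℕ → List ℕ → List (List (List ℕ))
blocks N []       = [] ∷ []
blocks N (k ∷ ks) = concatMap (λ b → map (b ∷_) (blocks N ks)) (tuples N k)

nondecr : List ℕ → Bool
nondecr (n ∷ ns@(n' ∷ _)) = (n ≤ᵇ n') ∧ nondecr ns
nondecr _ = true

firstOf : List ℕ → ℕ
firstOf []      = 0
firstOf (x ∷ _) = x

lastOf : List ℕ → ℕ
lastOf []           = 0
lastOf (x ∷ [])     = x
lastOf (_ ∷ xs@(_ ∷ _)) = lastOf xs

between : List ℕ → List (List ℕ) → Bool
between (k ∷ ks@(_ ∷ _)) (b ∷ bs@(b' ∷ _)) =
  (if k ≡ᵇ 1 then lastOf b ≤ᵇ firstOf b' else lastOf b <ᵇ firstOf b')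
  ∧ between ks bs
between _ _ = true

admissibleFamily : List ℕ → List (List ℕ) → Bool
admissibleFamily k bs = foldr (λ b acc → nondecr b ∧ acc) true bs ∧ between k bs

blockTerm : ℕ → List ℕ → ℚ
blockTerm N []       = 1ℚ
blockTerm N (x ∷ xs) = recip (N ∸ x) ℚ.* prodℚ (map recip xs)

rhs : ℕ → List ℕ → ℚ
rhs N k = sumℚ (map (λ bs → prodℚ (map (blockTerm N) bs))
  (filter (λ bs → admissibleFamily k bs ≟ true) (blocks N k)))

module Submission where

open import Defs
open import Data.Nat using (ℕ; _≤_)
open import Data.List using (List)
open import Data.List.Relation.Unary.All using (All)
open import Relation.Binary.PropositionalEquality using (_≡_)
open import Data.Nat using (suc)
open import Relation.Binary.PropositionalEquality using (sym; module ≡-Reasoning)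
open import Data.Bool using (true)

-- Write P = N − 1. Summing out everything but the first variable turns each side into a sum over
-- [1, P] of a summand: ζ♢-summand k ks n on the left (n = n₁) and rhs-summand k ks m on the right
-- (m = n₁,₁). The binomial connector K₀(n, m) = C(m−1, n−1) (N − m) / (n C(P, n)) relates them,
--   ζ♢-summand k ks n = Σₘ K₀(n, m) rhs-summand k ks m,
-- by induction on ks, because K₀ and K₁(n, m) = C(m−1, n−1) / C(P, n) intertwine the operations that
-- build the summands (tail sums over m′ > m or m′ ≥ m, weights 1/m and 1/(N − m)). These relations
-- reduce to the hockey-stick identity and to the telescoping sums Σ_{n′>n} K₀(n′, m) = C(m−1, n) / C(P, n);
-- the case n = 0 says that every column of K₀ sums to 1, so summing over n proves the theorem.

module FiniteSums where

  open import Data.Bool using (Bool; true; false; if_then_else_; _∧_; _≟_)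
  open import Data.List using ([]; _∷_; _++_; map; concatMap; filter)
  import Data.List.Properties as Listₚ
  open import Data.List.Relation.Unary.All as All using ([]; _∷_)
  import Data.List.Relation.Unary.All.Properties as Allₚ
  open import Data.Nat using (zero; _<_; z≤n; s≤s; s≤s⁻¹; _≤ᵇ_; _<ᵇ_)
  import Data.Nat.Properties as ℕₚ
  open import Data.Product using (_×_; _,_; map₂)
  open import Data.Rational using (ℚ; 0ℚ; _+_; _*_)
  import Data.Rational.Properties as ℚₚ
  open import Data.Rational.Solver using (module +-*-Solver)
  open import Data.Sum using (inj₁; inj₂)
  open import Relation.Binary.PropositionalEquality using (refl; sym; trans; cong; cong₂)

  private variable
    A B : Set

  infixr 8 [_]·_

  [_]·_ : Bool → ℚ → ℚ
  [ b ]· x = if b then x else 0ℚ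

  []·-*ˡ : ∀ b x y → [ b ]· (x * y) ≡ ([ b ]· x) * y
  []·-*ˡ true  x y = refl
  []·-*ˡ false x y = sym (ℚₚ.*-zeroˡ y)

  []·-*ʳ : ∀ b x y → [ b ]· (x * y) ≡ x * [ b ]· y
  []·-*ʳ true  x y = refl
  []·-*ʳ false x y = sym (ℚₚ.*-zeroʳ x)

  []·-+ : ∀ b x y → [ b ]· (x + y) ≡ [ b ]· x + [ b ]· y
  []·-+ true  x y = refl
  []·-+ false x y = refl

  []·-comm : ∀ a b x → [ a ]· [ b ]· x ≡ [ b ]· [ a ]· x
  []·-comm true  b     x = refl
  []·-comm false true  x = refl
  []·-comm false false x = refl

  []·-∧-*ʳ : ∀ a b x y → [ a ∧ b ]· (x * y) ≡ [ a ]· (x * [ b ]· y)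
  []·-∧-*ʳ true  b x y = []·-*ʳ b x y
  []·-∧-*ʳ false b x y = refl

  []·-∧-*-assoc : ∀ a b (r p g : ℚ) → [ a ∧ b ]· ((r * p) * g) ≡ [ a ]· (r * [ b ]· (p * g))
  []·-∧-*-assoc a b r p g = trans (cong ([ a ∧ b ]·_) (ℚₚ.*-assoc r p g)) ([]·-∧-*ʳ a b r (p * g))

  ∑ : List A → (A → ℚ) → ℚ
  ∑ xs f = sumℚ (map f xs)

  infix 5 ∑
  syntax ∑ xs (λ x → e) = ∑[ x ∈ xs ] e

  ∑-congᴬ : ∀ {xs : List A} {f g : A → ℚ} →
    All (λ x → f x ≡ g x) xs → ∑ xs f ≡ ∑ xs g
  ∑-congᴬ []       = refl
  ∑-congᴬ (p ∷ ps) = cong₂ _+_ p (∑-congᴬ ps)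

  ∑-cong : ∀ (xs : List A) {f g : A → ℚ} → (∀ x → f x ≡ g x) → ∑ xs f ≡ ∑ xs g
  ∑-cong xs f≗g = ∑-congᴬ (All.universal f≗g xs)

  ∑-0 : ∀ (xs : List A) → ∑[ x ∈ xs ] 0ℚ ≡ 0ℚ
  ∑-0 []       = refl
  ∑-0 (x ∷ xs) = cong (0ℚ +_) (∑-0 xs)

  sumℚ-++ : ∀ (xs ys : List ℚ) → sumℚ (xs ++ ys) ≡ sumℚ xs + sumℚ ys
  sumℚ-++ []       ys = sym (ℚₚ.+-identityˡ _)
  sumℚ-++ (x ∷ xs) ys = trans (cong (x +_) (sumℚ-++ xs ys)) (sym (ℚₚ.+-assoc x _ _))

  sumℚ-concatMap : ∀ (xs : List A) (h : A → List ℚ) →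
    sumℚ (concatMap h xs) ≡ ∑[ x ∈ xs ] sumℚ (h x)
  sumℚ-concatMap []       h = refl
  sumℚ-concatMap (x ∷ xs) h =
    trans (sumℚ-++ (h x) (concatMap h xs)) (cong (sumℚ (h x) +_) (sumℚ-concatMap xs h))

  ∑-++ : ∀ (xs ys : List A) f → ∑ (xs ++ ys) f ≡ ∑ xs f + ∑ ys f
  ∑-++ xs ys f = trans (cong sumℚ (Listₚ.map-++ f xs ys)) (sumℚ-++ (map f xs) (map f ys))

  ∑-map : ∀ (xs : List A) (g : A → B) f → ∑ (map g xs) f ≡ ∑[ x ∈ xs ] f (g x)
  ∑-map xs g f = cong sumℚ (sym (Listₚ.map-∘ xs))

  ∑-concatMap : ∀ (xs : List A) (g : A → List B) f →
    ∑ (concatMap g xs) f ≡ ∑[ x ∈ xs ] ∑ (g x) f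
  ∑-concatMap xs g f =
    trans (cong sumℚ (Listₚ.map-concatMap f g xs)) (sumℚ-concatMap xs (λ x → map f (g x)))

  ∑-filter : ∀ (xs : List A) (b : A → Bool) f →
    ∑ (filter (λ x → b x ≟ true) xs) f ≡ ∑[ x ∈ xs ] [ b x ]· f x
  ∑-filter []       b f = refl
  ∑-filter (x ∷ xs) b f with b x
  ... | true  = cong (f x +_) (∑-filter xs b f)
  ... | false = trans (∑-filter xs b f) (sym (ℚₚ.+-identityˡ _))

  ∑-+ : ∀ (xs : List A) f g → ∑[ x ∈ xs ] (f x + g x) ≡ ∑ xs f + ∑ xs g
  ∑-+ []       f g = refl
  ∑-+ (x ∷ xs) f g = trans (cong (f x + g x +_) (∑-+ xs f g))
    (solve 4 (λ a b c d → (a :+ b) :+ (c :+ d) := (a :+ c) :+ (b :+ d)) refl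
       (f x) (g x) (∑ xs f) (∑ xs g))
    where open +-*-Solver

  ∑-*ˡ : ∀ (xs : List A) c f → ∑[ x ∈ xs ] (c * f x) ≡ c * ∑ xs f
  ∑-*ˡ []       c f = sym (ℚₚ.*-zeroʳ c)
  ∑-*ˡ (x ∷ xs) c f =
    trans (cong (c * f x +_) (∑-*ˡ xs c f)) (sym (ℚₚ.*-distribˡ-+ c (f x) (∑ xs f)))

  ∑-*ʳ : ∀ (xs : List A) c f → ∑[ x ∈ xs ] (f x * c) ≡ ∑ xs f * c
  ∑-*ʳ []       c f = sym (ℚₚ.*-zeroˡ c)
  ∑-*ʳ (x ∷ xs) c f =
    trans (cong (f x * c +_) (∑-*ʳ xs c f)) (sym (ℚₚ.*-distribʳ-+ c (f x) (∑ xs f)))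

  []·-∑ : ∀ b (xs : List A) f → [ b ]· ∑ xs f ≡ ∑[ x ∈ xs ] [ b ]· f x
  []·-∑ true  xs f = refl
  []·-∑ false xs f = sym (∑-0 xs)

  ∑-swap : ∀ (xs : List A) (ys : List B) (f : A → B → ℚ) →
    ∑[ x ∈ xs ] ∑[ y ∈ ys ] f x y ≡ ∑[ y ∈ ys ] ∑[ x ∈ xs ] f x y
  ∑-swap []       ys f = sym (∑-0 ys)
  ∑-swap (x ∷ xs) ys f = trans (cong (∑ ys (f x) +_) (∑-swap xs ys f))
    (sym (∑-+ ys (f x) (λ y → ∑[ x ∈ xs ] f x y)))

  ∑-if : ∀ b (xs : List A) f → ∑ (if b then xs else []) f ≡ [ b ]· ∑ xs f
  ∑-if true  xs f = refl
  ∑-if false xs f = refl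

  ∑-guarded-*ˡ : ∀ b (xs : List A) r f → ∑[ x ∈ xs ] [ b ]· (r * f x) ≡ [ b ]· (r * ∑ xs f)
  ∑-guarded-*ˡ b xs r f = trans (sym ([]·-∑ b xs (λ x → r * f x))) (cong ([ b ]·_) (∑-*ˡ xs r f))

  ∑-swap-guarded : ∀ (xs : List A) (ys : List B) (r : A → B → Bool) (F : A → B → ℚ) (v : B → ℚ) →
    ∑[ i ∈ xs ] ∑[ j ∈ ys ] [ r i j ]· (F i j * v j)
      ≡ ∑[ j ∈ ys ] (∑[ i ∈ xs ] [ r i j ]· F i j) * v j
  ∑-swap-guarded xs ys r F v = trans (∑-swap xs ys _) (∑-cong ys λ j →
    trans (∑-cong xs λ i → []·-*ˡ (r i j) (F i j) (v j))
          (∑-*ʳ xs (v j) (λ i → [ r i j ]· F i j)))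

  <ᵇ-true : ∀ {m n} → m < n → (m <ᵇ n) ≡ true
  <ᵇ-true {zero}  (s≤s _) = refl
  <ᵇ-true {suc m} (s≤s p) = <ᵇ-true p

  <ᵇ-false : ∀ {m n} → n ≤ m → (m <ᵇ n) ≡ false
  <ᵇ-false z≤n     = refl
  <ᵇ-false (s≤s p) = <ᵇ-false p

  ≤ᵇ-true : ∀ {m n} → m ≤ n → (m ≤ᵇ n) ≡ true
  ≤ᵇ-true {zero}  _ = refl
  ≤ᵇ-true {suc m} p = <ᵇ-true p

  ≤ᵇ-false : ∀ {m n} → n < m → (m ≤ᵇ n) ≡ false
  ≤ᵇ-false {suc m} (s≤s p) = <ᵇ-false p

  <ᵇ-suc : ∀ m n → (m <ᵇ suc n) ≡ (m ≤ᵇ n)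
  <ᵇ-suc zero    n = refl
  <ᵇ-suc (suc m) n = refl

  range-bounds : ∀ M → All (λ x → 1 ≤ x × x ≤ M) (range (suc M))
  range-bounds zero    = []
  range-bounds (suc M) =
    Allₚ.∷ʳ⁺ (All.map (map₂ ℕₚ.m≤n⇒m≤1+n) (range-bounds M)) (s≤s z≤n , ℕₚ.≤-refl)

  ∑-range-cong : ∀ M {f g : ℕ → ℚ} → (∀ x → 1 ≤ x → x ≤ M → f x ≡ g x) →
    ∑ (range (suc M)) f ≡ ∑ (range (suc M)) g
  ∑-range-cong M f≗g = ∑-congᴬ (All.map (λ (1≤x , x≤M) → f≗g _ 1≤x x≤M) (range-bounds M))

  ∑-range-zero : ∀ M {f : ℕ → ℚ} → (∀ x → 1 ≤ x → x ≤ M → f x ≡ 0ℚ) →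
    ∑ (range (suc M)) f ≡ 0ℚ
  ∑-range-zero M f≗0 = trans (∑-range-cong M f≗0) (∑-0 (range (suc M)))

  ∑-range-snoc : ∀ M f → ∑ (range (suc (suc M))) f ≡ ∑ (range (suc M)) f + f (suc M)
  ∑-range-snoc M f =
    trans (∑-++ (range (suc M)) (suc M ∷ []) f) (cong (∑ (range (suc M)) f +_) (ℚₚ.+-identityʳ _))

  ∑-range-prefix : ∀ {c} M (f : ℕ → ℚ) → c ≤ M →
    ∑[ i ∈ range (suc M) ] [ i ≤ᵇ c ]· f i ≡ ∑ (range (suc c)) f
  ∑-range-prefix {c} M f c≤M with ℕₚ.m≤n⇒m<n∨m≡n c≤M
  ... | inj₂ refl = ∑-range-cong c (λ i _ i≤c → cong ([_]· f i) (≤ᵇ-true i≤c))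
  ∑-range-prefix {c} (suc M) f _ | inj₁ c<1+M = begin
      ∑[ i ∈ range (suc (suc M)) ] [ i ≤ᵇ c ]· f i
        ≡⟨ ∑-range-snoc M _ ⟩
      (∑[ i ∈ range (suc M) ] [ i ≤ᵇ c ]· f i) + [ suc M ≤ᵇ c ]· f (suc M)
        ≡⟨ cong₂ _+_ (∑-range-prefix M f (s≤s⁻¹ c<1+M))
                     (cong ([_]· f (suc M)) (≤ᵇ-false c<1+M)) ⟩
      ∑ (range (suc c)) f + 0ℚ
        ≡⟨ ℚₚ.+-identityʳ _ ⟩
      ∑ (range (suc c)) f ∎
    where open ≡-Reasoning

  ∑-range-split : ∀ {x} M (f : ℕ → ℚ) → 1 ≤ x → x ≤ M →
    ∑[ y ∈ range (suc M) ] [ x ≤ᵇ y ]· f y ≡ f x + (∑[ y ∈ range (suc M) ] [ x <ᵇ y ]· f y)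
  ∑-range-split {x} (suc M) f 1≤x x≤1+M with ℕₚ.m≤n⇒m<n∨m≡n x≤1+M
  ... | inj₂ refl = begin
      ∑[ y ∈ range (suc x) ] [ x ≤ᵇ y ]· f y
        ≡⟨ ∑-range-snoc M _ ⟩
      (∑[ y ∈ range x ] [ x ≤ᵇ y ]· f y) + [ x ≤ᵇ x ]· f x
        ≡⟨ cong₂ _+_ (∑-range-zero M (λ y _ y≤M → cong ([_]· f y) (≤ᵇ-false (s≤s y≤M))))
                     (cong ([_]· f x) (≤ᵇ-true (ℕₚ.≤-refl {x}))) ⟩
      0ℚ + f x
        ≡⟨ solve 1 (λ a → con 0ℚ :+ a := a :+ (con 0ℚ :+ con 0ℚ)) refl (f x) ⟩
      f x + (0ℚ + 0ℚ)
        ≡⟨ cong (f x +_) (sym (cong₂ _+_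
             (∑-range-zero M (λ y _ y≤M → cong ([_]· f y) (<ᵇ-false (ℕₚ.m≤n⇒m≤1+n y≤M))))
             (cong ([_]· f x) (<ᵇ-false (ℕₚ.≤-refl {x}))))) ⟩
      f x + ((∑[ y ∈ range x ] [ x <ᵇ y ]· f y) + [ x <ᵇ x ]· f x)
        ≡⟨ cong (f x +_) (sym (∑-range-snoc M _)) ⟩
      f x + (∑[ y ∈ range (suc x) ] [ x <ᵇ y ]· f y) ∎
    where open ≡-Reasoning
          open +-*-Solver
  ... | inj₁ x<1+M = begin
      ∑[ y ∈ range (suc (suc M)) ] [ x ≤ᵇ y ]· f y
        ≡⟨ ∑-range-snoc M _ ⟩
      (∑[ y ∈ range (suc M) ] [ x ≤ᵇ y ]· f y) + [ x ≤ᵇ suc M ]· f (suc M)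
        ≡⟨ cong₂ _+_ (∑-range-split M f 1≤x (s≤s⁻¹ x<1+M))
                     (cong ([_]· f (suc M)) (≤ᵇ-true x≤1+M)) ⟩
      (f x + (∑[ y ∈ range (suc M) ] [ x <ᵇ y ]· f y)) + f (suc M)
        ≡⟨ ℚₚ.+-assoc (f x) _ _ ⟩
      f x + ((∑[ y ∈ range (suc M) ] [ x <ᵇ y ]· f y) + f (suc M))
        ≡⟨ cong (λ b → f x + ((∑[ y ∈ range (suc M) ] [ x <ᵇ y ]· f y) + [ b ]· f (suc M)))
                (sym (<ᵇ-true x<1+M)) ⟩
      f x + ((∑[ y ∈ range (suc M) ] [ x <ᵇ y ]· f y) + [ x <ᵇ suc M ]· f (suc M))
        ≡⟨ cong (f x +_) (sym (∑-range-snoc M _)) ⟩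
      f x + (∑[ y ∈ range (suc (suc M)) ] [ x <ᵇ y ]· f y) ∎
    where open ≡-Reasoning
  ∑-range-split zero f (s≤s z≤n) ()

module NatFractions where

  open import Data.Integer as ℤ using (+_)
  import Data.Integer.Properties as ℤₚ
  open import Data.Integer.Solver using () renaming (module +-*-Solver to ℤ-Solver)
  import Data.Nat as ℕ
  import Data.Nat.Properties as ℕₚ
  open import Data.Rational using (ℚ; 1ℚ; _+_; _*_; 1/_)
  open import Data.Rational.Literals using (fromℤ)
  import Data.Rational.Properties as ℚₚ
  open import Data.Rational.Solver using (module +-*-Solver)
  import Data.Rational.Unnormalised as ℚᵘ
  import Data.Rational.Unnormalised.Properties as ℚᵘₚ
  open import Relation.Binary.PropositionalEquality using (refl; sym; trans; cong; cong₂)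

  toℚ : ℕ → ℚ
  toℚ n = fromℤ (+ n)

  toℚ-+ : ∀ m n → toℚ (m ℕ.+ n) ≡ toℚ m + toℚ n
  toℚ-+ m n = ℚₚ.toℚᵘ-injective
    (ℚᵘₚ.≃-sym (ℚᵘₚ.≃-trans (ℚₚ.toℚᵘ-homo-+ (toℚ m) (toℚ n)) (ℚᵘ.*≡* eq)))
    where
    open ℤ-Solver
    eq : (+ m ℤ.* + 1 ℤ.+ + n ℤ.* + 1) ℤ.* + 1 ≡ + (m ℕ.+ n) ℤ.* (+ 1 ℤ.* + 1)
    eq = trans (solve 2 (λ x y → (x :* con (+ 1) :+ y :* con (+ 1)) :* con (+ 1)
                                   := (x :+ y) :* (con (+ 1) :* con (+ 1))) refl (+ m) (+ n))
               (cong (ℤ._* (+ 1 ℤ.* + 1)) (sym (ℤₚ.pos-+ m n)))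

  toℚ-* : ∀ m n → toℚ (m ℕ.* n) ≡ toℚ m * toℚ n
  toℚ-* m n = ℚₚ.toℚᵘ-injective
    (ℚᵘₚ.≃-sym (ℚᵘₚ.≃-trans (ℚₚ.toℚᵘ-homo-* (toℚ m) (toℚ n)) (ℚᵘ.*≡* eq)))
    where
    open ℤ-Solver
    eq : (+ m ℤ.* + n) ℤ.* + 1 ≡ + (m ℕ.* n) ℤ.* (+ 1 ℤ.* + 1)
    eq = trans (solve 2 (λ x y → (x :* y) :* con (+ 1) := (x :* y) :* (con (+ 1) :* con (+ 1)))
                        refl (+ m) (+ n))
               (cong (ℤ._* (+ 1 ℤ.* + 1)) (sym (ℤₚ.pos-* m n)))

  recip-suc : ∀ n → recip (suc n) ≡ 1/ toℚ (suc n)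
  recip-suc n = ℚₚ.↥p/↧p≡p (1/ toℚ (suc n))

  toℚ*recip : ∀ {n} → 1 ≤ n → toℚ n * recip n ≡ 1ℚ
  toℚ*recip {suc n} _ = trans (cong (toℚ (suc n) *_) (recip-suc n)) (ℚₚ.*-inverseʳ (toℚ (suc n)))

  toℚ-*-cancelˡ : ∀ {d x y} → 1 ≤ d → toℚ d * x ≡ toℚ d * y → x ≡ y
  toℚ-*-cancelˡ {d} {x} {y} 1≤d eq = begin
    x                        ≡⟨ sym (trans (cong (_* x) (toℚ*recip 1≤d)) (ℚₚ.*-identityˡ x)) ⟩
    (toℚ d * recip d) * x    ≡⟨ reorder x ⟩
    recip d * (toℚ d * x)    ≡⟨ cong (recip d *_) eq ⟩
    recip d * (toℚ d * y)    ≡⟨ sym (reorder y) ⟩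
    (toℚ d * recip d) * y    ≡⟨ trans (cong (_* y) (toℚ*recip 1≤d)) (ℚₚ.*-identityˡ y) ⟩
    y                        ∎
    where
    open ≡-Reasoning
    open +-*-Solver
    reorder : ∀ z → (toℚ d * recip d) * z ≡ recip d * (toℚ d * z)
    reorder = solve 3 (λ t r z → (t :* r) :* z := r :* (t :* z)) refl (toℚ d) (recip d)

  interchange : ∀ a b c d → (a * b) * (c * d) ≡ (a * c) * (b * d)
  interchange = solve 4 (λ a b c d → (a :* b) :* (c :* d) := (a :* c) :* (b :* d)) refl
    where open +-*-Solver

  recip-* : ∀ {m n} → 1 ≤ m → 1 ≤ n → recip (m ℕ.* n) ≡ recip m * recip n
  recip-* {m} {n} 1≤m 1≤n = toℚ-*-cancelˡ (ℕₚ.*-mono-≤ 1≤m 1≤n) (begin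
    toℚ (m ℕ.* n) * recip (m ℕ.* n)       ≡⟨ toℚ*recip (ℕₚ.*-mono-≤ 1≤m 1≤n) ⟩
    1ℚ                                     ≡⟨ sym (cong₂ _*_ (toℚ*recip 1≤m) (toℚ*recip 1≤n)) ⟩
    (toℚ m * recip m) * (toℚ n * recip n)  ≡⟨ interchange (toℚ m) (recip m) (toℚ n) (recip n) ⟩
    (toℚ m * toℚ n) * (recip m * recip n)  ≡⟨ cong (_* (recip m * recip n)) (sym (toℚ-* m n)) ⟩
    toℚ (m ℕ.* n) * (recip m * recip n)    ∎)
    where open ≡-Reasoning

  infixl 7 _/ₙ_

  _/ₙ_ : ℕ → ℕ → ℚ
  a /ₙ b = toℚ a * recip b

  /ₙ-+ : ∀ a b c → a /ₙ c + b /ₙ c ≡ (a ℕ.+ b) /ₙ c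
  /ₙ-+ a b c =
    trans (sym (ℚₚ.*-distribʳ-+ (recip c) (toℚ a) (toℚ b))) (cong (_* recip c) (sym (toℚ-+ a b)))

  /ₙ-* : ∀ a b {c d} → 1 ≤ c → 1 ≤ d → (a /ₙ c) * (b /ₙ d) ≡ (a ℕ.* b) /ₙ (c ℕ.* d)
  /ₙ-* a b {c} {d} 1≤c 1≤d = trans (interchange (toℚ a) (recip c) (toℚ b) (recip d))
                                   (sym (cong₂ _*_ (toℚ-* a b) (recip-* 1≤c 1≤d)))

  /ₙ-cancelʳ : ∀ a {c d} → 1 ≤ c → 1 ≤ d → (a ℕ.* d) /ₙ (c ℕ.* d) ≡ a /ₙ c
  /ₙ-cancelʳ a {c} {d} 1≤c 1≤d = begin
    (a ℕ.* d) /ₙ (c ℕ.* d)  ≡⟨ sym (/ₙ-* a d 1≤c 1≤d) ⟩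
    (a /ₙ c) * (d /ₙ d)      ≡⟨ cong ((a /ₙ c) *_) (toℚ*recip 1≤d) ⟩
    (a /ₙ c) * 1ℚ           ≡⟨ ℚₚ.*-identityʳ (a /ₙ c) ⟩
    a /ₙ c                  ∎
    where open ≡-Reasoning

  /ₙ-cross : ∀ {a b c d} → 1 ≤ c → 1 ≤ d → a ℕ.* d ≡ b ℕ.* c → a /ₙ c ≡ b /ₙ d
  /ₙ-cross {a} {b} {c} {d} 1≤c 1≤d ad≡bc = begin
    a /ₙ c                  ≡⟨ sym (/ₙ-cancelʳ a 1≤c 1≤d) ⟩
    (a ℕ.* d) /ₙ (c ℕ.* d)  ≡⟨ cong₂ _/ₙ_ ad≡bc (ℕₚ.*-comm c d) ⟩
    (b ℕ.* c) /ₙ (d ℕ.* c)  ≡⟨ /ₙ-cancelʳ b 1≤d 1≤c ⟩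
    b /ₙ d                  ∎
    where open ≡-Reasoning

  /ₙ-*-recip : ∀ a {c d} → 1 ≤ c → 1 ≤ d → (a /ₙ c) * recip d ≡ a /ₙ (c ℕ.* d)
  /ₙ-*-recip a {c} {d} 1≤c 1≤d =
    trans (ℚₚ.*-assoc (toℚ a) (recip c) (recip d)) (cong (toℚ a *_) (sym (recip-* 1≤c 1≤d)))

module Binomials where

  open import Data.Nat
  open import Data.Nat.Properties
  open import Data.Nat.Combinatorics using (_C_; nC1≡n; k>n⇒nCk≡0; nCk+nC[k+1]≡[n+1]C[k+1])
  open import Relation.Binary.PropositionalEquality using (refl; sym; trans; cong; cong₂)
  open import Relation.Nullary using (yes; no)

  C-pos : ∀ {n k} → k ≤ n → 1 ≤ n C k
  C-pos {n}     {zero}  _         = ≤-refl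
  C-pos {suc n} {suc k} (s≤s k≤n) = begin
    1                        ≤⟨ C-pos k≤n ⟩
    n C k                    ≤⟨ m≤m+n (n C k) _ ⟩
    n C k + n C suc k        ≡⟨ nCk+nC[k+1]≡[n+1]C[k+1] n k ⟩
    suc n C suc k            ∎
    where open ≤-Reasoning

  C-absorb : ∀ n k → suc k * (suc n C suc k) ≡ suc n * (n C k)
  C-absorb n       zero    = trans (+-identityʳ _) (trans (nC1≡n (suc n)) (sym (*-identityʳ (suc n))))
  C-absorb zero    (suc k) = *-zeroʳ (suc (suc k))
  C-absorb (suc n) (suc k) = begin
    suc (suc k) * (suc (suc n) C suc (suc k))
      ≡⟨ cong (suc (suc k) *_) (sym (nCk+nC[k+1]≡[n+1]C[k+1] (suc n) (suc k))) ⟩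
    suc (suc k) * (suc n C suc k + suc n C suc (suc k))
      ≡⟨ *-distribˡ-+ (suc (suc k)) (suc n C suc k) _ ⟩
    suc n C suc k + suc k * (suc n C suc k) + suc (suc k) * (suc n C suc (suc k))
      ≡⟨ cong₂ (λ x y → suc n C suc k + x + y) (C-absorb n k) (C-absorb n (suc k)) ⟩
    suc n C suc k + suc n * (n C k) + suc n * (n C suc k)
      ≡⟨ +-assoc (suc n C suc k) _ _ ⟩
    suc n C suc k + (suc n * (n C k) + suc n * (n C suc k))
      ≡⟨ cong (suc n C suc k +_) (sym (*-distribˡ-+ (suc n) (n C k) _)) ⟩
    suc n C suc k + suc n * (n C k + n C suc k)
      ≡⟨ cong (λ x → suc n C suc k + suc n * x) (nCk+nC[k+1]≡[n+1]C[k+1] n k) ⟩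
    suc (suc n) * (suc n C suc k)
      ∎
    where open ≡-Reasoning

  C-step : ∀ n k → suc k * (n C suc k) ≡ (n ∸ k) * (n C k)
  C-step n k = begin
    suc k * (n C suc k)
      ≡⟨ sym (m+n∸m≡n (suc k * (n C k)) _) ⟩
    (suc k * (n C k) + suc k * (n C suc k)) ∸ suc k * (n C k)
      ≡⟨ cong (_∸ suc k * (n C k)) pascal-absorb ⟩
    suc n * (n C k) ∸ suc k * (n C k)
      ≡⟨ sym (*-distribʳ-∸ (n C k) (suc n) (suc k)) ⟩
    (n ∸ k) * (n C k) ∎
    where
    open ≡-Reasoning
    pascal-absorb : suc k * (n C k) + suc k * (n C suc k) ≡ suc n * (n C k)
    pascal-absorb = trans (sym (*-distribˡ-+ (suc k) (n C k) _))
                          (trans (cong (suc k *_) (nCk+nC[k+1]≡[n+1]C[k+1] n k)) (C-absorb n k))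

  C-tail-step : ∀ {a P} n → a ≤ P → (a C n) * (P ∸ a) + suc n * (a C suc n) ≡ (a C n) * (P ∸ n)
  C-tail-step {a} {P} n a≤P with n ≤? a
  ... | yes n≤a = begin
    (a C n) * (P ∸ a) + suc n * (a C suc n)
      ≡⟨ cong ((a C n) * (P ∸ a) +_) (trans (C-step a n) (*-comm (a ∸ n) (a C n))) ⟩
    (a C n) * (P ∸ a) + (a C n) * (a ∸ n)
      ≡⟨ sym (*-distribˡ-+ (a C n) (P ∸ a) (a ∸ n)) ⟩
    (a C n) * ((P ∸ a) + (a ∸ n))
      ≡⟨ cong ((a C n) *_) gaps ⟩
    (a C n) * (P ∸ n) ∎
    where
    open ≡-Reasoning
    gaps : (P ∸ a) + (a ∸ n) ≡ P ∸ n
    gaps = trans (sym (+-∸-assoc (P ∸ a) n≤a)) (cong (_∸ n) (m∸n+n≡m a≤P))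
  ... | no n≰a
    rewrite k>n⇒nCk≡0 (≰⇒> n≰a) | k>n⇒nCk≡0 (m<n⇒m<1+n (≰⇒> n≰a)) | *-zeroʳ (suc n) = refl

  C-tail-identity : ∀ {a P} n → a ≤ P →
    ((a C n) * (P ∸ a) + (a C suc n) * suc n) * (P C n) ≡ (a C n) * ((P C suc n) * suc n)
  C-tail-identity {a} {P} n a≤P = begin
    ((a C n) * (P ∸ a) + (a C suc n) * suc n) * (P C n)
      ≡⟨ cong (λ x → ((a C n) * (P ∸ a) + x) * (P C n)) (*-comm (a C suc n) (suc n)) ⟩
    ((a C n) * (P ∸ a) + suc n * (a C suc n)) * (P C n)
      ≡⟨ cong (_* (P C n)) (C-tail-step n a≤P) ⟩
    (a C n) * (P ∸ n) * (P C n)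
      ≡⟨ *-assoc (a C n) (P ∸ n) (P C n) ⟩
    (a C n) * ((P ∸ n) * (P C n))
      ≡⟨ cong ((a C n) *_) (trans (sym (C-step P n)) (*-comm (suc n) (P C suc n))) ⟩
    (a C n) * ((P C suc n) * suc n) ∎
    where open ≡-Reasoning

module Connector (P : ℕ) where

  open FiniteSums
  open NatFractions
  open Binomials
  open import Data.Bool using (Bool)
  open import Data.Nat as ℕ using (zero; _<_; z≤n; s≤s; _≤ᵇ_; _<ᵇ_; _∸_; _^_)
  import Data.Nat.Properties as ℕₚ
  open import Data.Nat.Combinatorics using (_C_; k>n⇒nCk≡0; nCk+nC[k+1]≡[n+1]C[k+1])
  open import Data.Nat.Solver using () renaming (module +-*-Solver to ℕ-Solver)
  open import Data.Rational using (ℚ; 0ℚ; 1ℚ; _+_; _*_)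
  import Data.Rational.Properties as ℚₚ
  open import Data.Rational.Solver using (module +-*-Solver)
  open import Relation.Binary.PropositionalEquality using (refl; sym; trans; cong; cong₂)

  hockey-stick : ∀ M k → ∑[ m ∈ range (suc M) ] toℚ ((m ∸ 1) C k) ≡ toℚ (M C suc k)
  hockey-stick zero    k = refl
  hockey-stick (suc M) k = begin
    ∑[ m ∈ range (suc (suc M)) ] toℚ ((m ∸ 1) C k)
      ≡⟨ ∑-range-snoc M _ ⟩
    (∑[ m ∈ range (suc M) ] toℚ ((m ∸ 1) C k)) + toℚ (M C k)
      ≡⟨ cong (_+ toℚ (M C k)) (hockey-stick M k) ⟩
    toℚ (M C suc k) + toℚ (M C k)
      ≡⟨ ℚₚ.+-comm (toℚ (M C suc k)) (toℚ (M C k)) ⟩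
    toℚ (M C k) + toℚ (M C suc k)
      ≡⟨ sym (toℚ-+ (M C k) _) ⟩
    toℚ (M C k ℕ.+ M C suc k)
      ≡⟨ cong toℚ (nCk+nC[k+1]≡[n+1]C[k+1] M k) ⟩
    toℚ (suc M C suc k) ∎
    where open ≡-Reasoning

  N : ℕ
  N = suc P

  Σ> Σ≥ : (ℕ → ℚ) → ℕ → ℚ
  Σ> v x = ∑[ y ∈ range N ] [ x <ᵇ y ]· v y
  Σ≥ v x = ∑[ y ∈ range N ] [ x ≤ᵇ y ]· v y

  -- chainSum j g x = Σ_{x ≤ y₁ ≤ ⋯ ≤ y_j} g(y_j) / (y₁ ⋯ y_j)
  chainSum : ℕ → (ℕ → ℚ) → ℕ → ℚ
  chainSum zero    g = g
  chainSum (suc j) g = Σ≥ (λ y → recip y * chainSum j g y)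

  K₁ K₀ : ℕ → ℕ → ℚ
  K₁ n m = ((m ∸ 1) C (n ∸ 1)) /ₙ (P C n)
  K₀ n m = K₁ n m * ((N ∸ m) /ₙ n)

  infixr 9 _⊛_

  _⊛_ : (ℕ → ℕ → ℚ) → (ℕ → ℚ) → ℕ → ℚ
  (K ⊛ w) n = ∑[ m ∈ range N ] K n m * w m

  ⊛-cong : ∀ K {v w : ℕ → ℚ} n → (∀ m → 1 ≤ m → m ≤ P → v m ≡ w m) →
    (K ⊛ v) n ≡ (K ⊛ w) n
  ⊛-cong K n v≗w = ∑-range-cong P (λ m 1≤m m≤P → cong (K n m *_) (v≗w m 1≤m m≤P))

  ⊛-+ : ∀ K (v w : ℕ → ℚ) n → (K ⊛ (λ m → v m + w m)) n ≡ (K ⊛ v) n + (K ⊛ w) n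
  ⊛-+ K v w n = trans (∑-cong (range N) (λ m → ℚₚ.*-distribˡ-+ (K n m) (v m) (w m)))
                      (∑-+ (range N) (λ m → K n m * v m) (λ m → K n m * w m))

  ⊛-guarded-∑ : ∀ K (r : ℕ → ℕ → Bool) (v : ℕ → ℚ) n →
    (K ⊛ (λ m → ∑[ m′ ∈ range N ] [ r m m′ ]· v m′)) n
      ≡ ∑[ m′ ∈ range N ] (∑[ m ∈ range N ] [ r m m′ ]· K n m) * v m′
  ⊛-guarded-∑ K r v n = trans
    (∑-cong (range N) λ m → trans (sym (∑-*ˡ (range N) (K n m) _))
                                  (∑-cong (range N) λ m′ → sym ([]·-*ʳ (r m m′) (K n m) (v m′))))
    (∑-swap-guarded (range N) (range N) r (λ m _ → K n m) v)

  guarded-∑-⊛ : ∀ K (b : ℕ → Bool) (w : ℕ → ℚ) →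
    ∑[ n ∈ range N ] [ b n ]· (K ⊛ w) n
      ≡ ∑[ m ∈ range N ] (∑[ n ∈ range N ] [ b n ]· K n m) * w m
  guarded-∑-⊛ K b w = trans
    (∑-cong (range N) λ n → []·-∑ (b n) (range N) (λ m → K n m * w m))
    (∑-swap-guarded (range N) (range N) (λ n _ → b n) K w)

  K₁-prefix-sum : ∀ {n c} → 1 ≤ n → c ≤ P →
    ∑[ m ∈ range N ] [ m ≤ᵇ c ]· K₁ n m ≡ (c C n) /ₙ (P C n)
  K₁-prefix-sum {suc k} {c} _ c≤P = begin
    ∑[ m ∈ range N ] [ m ≤ᵇ c ]· K₁ (suc k) m
      ≡⟨ ∑-range-prefix P (K₁ (suc k)) c≤P ⟩
    ∑[ m ∈ range (suc c) ] toℚ ((m ∸ 1) C k) * recip (P C suc k)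
      ≡⟨ ∑-*ʳ (range (suc c)) _ (λ m → toℚ ((m ∸ 1) C k)) ⟩
    (∑[ m ∈ range (suc c) ] toℚ ((m ∸ 1) C k)) * recip (P C suc k)
      ≡⟨ cong (_* recip (P C suc k)) (hockey-stick c k) ⟩
    (c C suc k) /ₙ (P C suc k) ∎
    where open ≡-Reasoning

  K₁-⊛-1 : ∀ {n} → 1 ≤ n → n ≤ P → (K₁ ⊛ (λ _ → 1ℚ)) n ≡ 1ℚ
  K₁-⊛-1 {n} 1≤n n≤P = begin
    ∑[ m ∈ range N ] K₁ n m * 1ℚ
      ≡⟨ ∑-range-cong P (λ m _ m≤P →
           trans (ℚₚ.*-identityʳ _) (cong (λ b → [ b ]· K₁ n m) (sym (≤ᵇ-true m≤P)))) ⟩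
    ∑[ m ∈ range N ] [ m ≤ᵇ P ]· K₁ n m
      ≡⟨ K₁-prefix-sum 1≤n ℕₚ.≤-refl ⟩
    (P C n) /ₙ (P C n)
      ≡⟨ toℚ*recip (C-pos n≤P) ⟩
    1ℚ ∎
    where open ≡-Reasoning

  1≤N∸ : ∀ {m} → m ≤ P → 1 ≤ N ∸ m
  1≤N∸ m≤P = ℕₚ.m<n⇒0<n∸m (s≤s m≤P)

  K₀-*-recip : ∀ n {m} → m ≤ P → K₀ n m * recip (N ∸ m) ≡ recip n * K₁ n m
  K₀-*-recip n {m} m≤P = begin
    K₁ n m * (toℚ (N ∸ m) * recip n) * recip (N ∸ m)
      ≡⟨ solve 4 (λ k t r s → k :* (t :* r) :* s := (t :* s) :* (r :* k)) refl
           (K₁ n m) (toℚ (N ∸ m)) (recip n) (recip (N ∸ m)) ⟩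
    (toℚ (N ∸ m) * recip (N ∸ m)) * (recip n * K₁ n m)
      ≡⟨ cong (_* (recip n * K₁ n m)) (toℚ*recip (1≤N∸ m≤P)) ⟩
    1ℚ * (recip n * K₁ n m)
      ≡⟨ ℚₚ.*-identityˡ _ ⟩
    recip n * K₁ n m ∎
    where
    open ≡-Reasoning
    open +-*-Solver

  K₀-⊛-recip : ∀ (w : ℕ → ℚ) n →
    (K₀ ⊛ (λ m → recip (N ∸ m) * w m)) n ≡ recip n * (K₁ ⊛ w) n
  K₀-⊛-recip w n =
    trans (∑-range-cong P pointwise) (∑-*ˡ (range N) (recip n) (λ m → K₁ n m * w m))
    where
    pointwise : ∀ m → 1 ≤ m → m ≤ P →
      K₀ n m * (recip (N ∸ m) * w m) ≡ recip n * (K₁ n m * w m)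
    pointwise m _ m≤P = begin
      K₀ n m * (recip (N ∸ m) * w m)  ≡⟨ sym (ℚₚ.*-assoc (K₀ n m) _ _) ⟩
      K₀ n m * recip (N ∸ m) * w m    ≡⟨ cong (_* w m) (K₀-*-recip n m≤P) ⟩
      recip n * K₁ n m * w m          ≡⟨ ℚₚ.*-assoc (recip n) _ _ ⟩
      recip n * (K₁ n m * w m)        ∎
      where open ≡-Reasoning

  K₀-tail-step : ∀ {n a} → n < P → a < P →
    K₀ (suc n) (suc a) + (a C suc n) /ₙ (P C suc n) ≡ (a C n) /ₙ (P C n)
  K₀-tail-step {n} {a} n<P a<P = begin
    ((a C n) /ₙ (P C suc n)) * ((P ∸ a) /ₙ suc n) + (a C suc n) /ₙ (P C suc n)
      ≡⟨ cong₂ _+_ (/ₙ-* (a C n) (P ∸ a) 1≤C 1≤1+n) (sym (/ₙ-cancelʳ (a C suc n) 1≤C 1≤1+n)) ⟩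
    ((a C n) ℕ.* (P ∸ a)) /ₙ D + ((a C suc n) ℕ.* suc n) /ₙ D
      ≡⟨ /ₙ-+ ((a C n) ℕ.* (P ∸ a)) ((a C suc n) ℕ.* suc n) D ⟩
    ((a C n) ℕ.* (P ∸ a) ℕ.+ (a C suc n) ℕ.* suc n) /ₙ D
      ≡⟨ /ₙ-cross (ℕₚ.*-mono-≤ 1≤C 1≤1+n) (C-pos (ℕₚ.<⇒≤ n<P))
                  (C-tail-identity n (ℕₚ.<⇒≤ a<P)) ⟩
    (a C n) /ₙ (P C n) ∎
    where
    open ≡-Reasoning
    1≤C : 1 ≤ P C suc n
    1≤C = C-pos n<P
    1≤1+n : 1 ≤ suc n
    1≤1+n = s≤s z≤n
    D = (P C suc n) ℕ.* suc n

  K₀-tail-sum : ∀ {n m} → n ≤ P → 1 ≤ m → m ≤ P →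
    ∑[ n′ ∈ range N ] [ n <ᵇ n′ ]· K₀ n′ m ≡ ((m ∸ 1) C n) /ₙ (P C n)
  K₀-tail-sum {n} n≤P = by-distance-to-top (P ∸ n) (ℕₚ.m+[n∸m]≡n n≤P)
    where
    by-distance-to-top : ∀ d {n m} → n ℕ.+ d ≡ P → 1 ≤ m → m ≤ P →
      ∑[ n′ ∈ range N ] [ n <ᵇ n′ ]· K₀ n′ m ≡ ((m ∸ 1) C n) /ₙ (P C n)
    by-distance-to-top zero {n} {suc a} n+0≡P _ a<P with trans (sym (ℕₚ.+-identityʳ n)) n+0≡P
    ... | refl = begin
      ∑[ n′ ∈ range N ] [ P <ᵇ n′ ]· K₀ n′ (suc a)
        ≡⟨ ∑-range-zero P (λ n′ _ n′≤P → cong ([_]· K₀ n′ (suc a)) (<ᵇ-false n′≤P)) ⟩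
      0ℚ
        ≡⟨ sym (ℚₚ.*-zeroˡ (recip (P C P))) ⟩
      toℚ 0 * recip (P C P)
        ≡⟨ cong (λ c → toℚ c * recip (P C P)) (sym (k>n⇒nCk≡0 a<P)) ⟩
      (a C P) /ₙ (P C P) ∎
      where open ≡-Reasoning
    by-distance-to-top (suc d) {n} {m@(suc a)} n+1+d≡P 1≤m a<P = begin
      ∑[ n′ ∈ range N ] [ suc n ≤ᵇ n′ ]· K₀ n′ m
        ≡⟨ ∑-range-split P (λ n′ → K₀ n′ m) (s≤s z≤n) n<P ⟩
      K₀ (suc n) m + (∑[ n′ ∈ range N ] [ suc n <ᵇ n′ ]· K₀ n′ m)
        ≡⟨ cong (K₀ (suc n) m +_) (by-distance-to-top d 1+n+d≡P 1≤m a<P) ⟩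
      K₀ (suc n) m + (a C suc n) /ₙ (P C suc n)
        ≡⟨ K₀-tail-step n<P a<P ⟩
      (a C n) /ₙ (P C n) ∎
      where
      open ≡-Reasoning
      1+n+d≡P : suc n ℕ.+ d ≡ P
      1+n+d≡P = trans (sym (ℕₚ.+-suc n d)) n+1+d≡P
      n<P : n < P
      n<P = ℕₚ.≤-trans (ℕₚ.m≤m+n (suc n) d) (ℕₚ.≤-reflexive 1+n+d≡P)

  K₁-absorb : ∀ {n m} → 1 ≤ n → n ≤ P → 1 ≤ m →
    ((m C n) /ₙ (P C n)) * recip m ≡ recip n * K₁ n m
  K₁-absorb {n@(suc k)} {m@(suc a)} _ n≤P _ = begin
    ((m C n) /ₙ (P C n)) * recip m    ≡⟨ /ₙ-*-recip (m C n) 1≤C (s≤s z≤n) ⟩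
    (m C n) /ₙ ((P C n) ℕ.* m)        ≡⟨ /ₙ-cross 1≤Cn 1≤Cn cross ⟩
    (a C k) /ₙ ((P C n) ℕ.* n)        ≡⟨ sym (/ₙ-*-recip (a C k) 1≤C (s≤s z≤n)) ⟩
    ((a C k) /ₙ (P C n)) * recip n    ≡⟨ ℚₚ.*-comm ((a C k) /ₙ (P C n)) (recip n) ⟩
    recip n * K₁ n m                  ∎
    where
    open ≡-Reasoning
    1≤C : 1 ≤ P C n
    1≤C = C-pos n≤P
    1≤Cn : ∀ {d} → 1 ≤ (P C n) ℕ.* suc d
    1≤Cn = ℕₚ.*-mono-≤ 1≤C (s≤s z≤n)
    cross : (m C n) ℕ.* ((P C n) ℕ.* n) ≡ (a C k) ℕ.* ((P C n) ℕ.* m)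
    cross = begin
      (m C n) ℕ.* ((P C n) ℕ.* n)
        ≡⟨ solve 3 (λ x y z → x :* (y :* z) := y :* (z :* x)) refl (m C n) (P C n) n ⟩
      (P C n) ℕ.* (n ℕ.* (m C n))
        ≡⟨ cong ((P C n) ℕ.*_) (C-absorb a k) ⟩
      (P C n) ℕ.* (m ℕ.* (a C k))
        ≡⟨ solve 3 (λ x y z → x :* (y :* z) := z :* (x :* y)) refl (P C n) m (a C k) ⟩
      (a C k) ℕ.* ((P C n) ℕ.* m) ∎
      where open ℕ-Solver

  recip-K₁ : ∀ (w : ℕ → ℚ) {n} → 1 ≤ n → n ≤ P →
    recip n * (K₁ ⊛ w) n ≡ (K₁ ⊛ Σ≥ (λ y → recip y * w y)) n
  recip-K₁ w {n} 1≤n n≤P = sym (begin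
    (K₁ ⊛ Σ≥ (λ y → recip y * w y)) n
      ≡⟨ ⊛-guarded-∑ K₁ _≤ᵇ_ (λ y → recip y * w y) n ⟩
    ∑[ m′ ∈ range N ] (∑[ m ∈ range N ] [ m ≤ᵇ m′ ]· K₁ n m) * (recip m′ * w m′)
      ≡⟨ ∑-range-cong P pointwise ⟩
    ∑[ m′ ∈ range N ] recip n * (K₁ n m′ * w m′)
      ≡⟨ ∑-*ˡ (range N) (recip n) (λ m′ → K₁ n m′ * w m′) ⟩
    recip n * (K₁ ⊛ w) n ∎)
    where
    open ≡-Reasoning
    pointwise : ∀ m′ → 1 ≤ m′ → m′ ≤ P →
      (∑[ m ∈ range N ] [ m ≤ᵇ m′ ]· K₁ n m) * (recip m′ * w m′) ≡ recip n * (K₁ n m′ * w m′)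
    pointwise m′ 1≤m′ m′≤P = begin
      (∑[ m ∈ range N ] [ m ≤ᵇ m′ ]· K₁ n m) * (recip m′ * w m′)
        ≡⟨ cong (_* (recip m′ * w m′)) (K₁-prefix-sum 1≤n m′≤P) ⟩
      ((m′ C n) /ₙ (P C n)) * (recip m′ * w m′)
        ≡⟨ sym (ℚₚ.*-assoc ((m′ C n) /ₙ (P C n)) (recip m′) (w m′)) ⟩
      ((m′ C n) /ₙ (P C n)) * recip m′ * w m′
        ≡⟨ cong (_* w m′) (K₁-absorb 1≤n n≤P 1≤m′) ⟩
      recip n * K₁ n m′ * w m′
        ≡⟨ ℚₚ.*-assoc (recip n) (K₁ n m′) (w m′) ⟩
      recip n * (K₁ n m′ * w m′) ∎

  Σ>-K₀ : ∀ (w : ℕ → ℚ) {n} → 1 ≤ n → n ≤ P → Σ> (K₀ ⊛ w) n ≡ (K₁ ⊛ Σ> w) n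
  Σ>-K₀ w {n} 1≤n n≤P = begin
    ∑[ n′ ∈ range N ] [ n <ᵇ n′ ]· (K₀ ⊛ w) n′
      ≡⟨ guarded-∑-⊛ K₀ (n <ᵇ_) w ⟩
    ∑[ m ∈ range N ] (∑[ n′ ∈ range N ] [ n <ᵇ n′ ]· K₀ n′ m) * w m
      ≡⟨ ∑-range-cong P (λ m 1≤m m≤P → cong (_* w m) (K₀-tail-sum n≤P 1≤m m≤P)) ⟩
    ∑[ m ∈ range N ] (((m ∸ 1) C n) /ₙ (P C n)) * w m
      ≡⟨ sym (∑-range-cong P (λ m 1≤m m≤P → cong (_* w m) (strict-prefix 1≤m m≤P))) ⟩
    ∑[ m′ ∈ range N ] (∑[ m ∈ range N ] [ m <ᵇ m′ ]· K₁ n m) * w m′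
      ≡⟨ sym (⊛-guarded-∑ K₁ _<ᵇ_ w n) ⟩
    (K₁ ⊛ Σ> w) n ∎
    where
    open ≡-Reasoning
    strict-prefix : ∀ {m′} → 1 ≤ m′ → m′ ≤ P →
      ∑[ m ∈ range N ] [ m <ᵇ m′ ]· K₁ n m ≡ ((m′ ∸ 1) C n) /ₙ (P C n)
    strict-prefix {suc a} _ a<P = trans (∑-cong (range N) λ m → cong ([_]· K₁ n m) (<ᵇ-suc m a))
                                        (K₁-prefix-sum 1≤n (ℕₚ.<⇒≤ a<P))

  C-step-/ₙ : ∀ {k} b → k < P →
    recip (P ∸ k) * (b /ₙ (P C k)) ≡ recip (suc k) * (b /ₙ (P C suc k))
  C-step-/ₙ {k} b k<P = begin
    recip (P ∸ k) * (b /ₙ (P C k))       ≡⟨ ℚₚ.*-comm (recip (P ∸ k)) (b /ₙ (P C k)) ⟩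
    (b /ₙ (P C k)) * recip (P ∸ k)
                                         ≡⟨ /ₙ-*-recip b (C-pos (ℕₚ.<⇒≤ k<P)) (ℕₚ.m<n⇒0<n∸m k<P) ⟩
    b /ₙ ((P C k) ℕ.* (P ∸ k))           ≡⟨ cong (b /ₙ_) denominators ⟩
    b /ₙ ((P C suc k) ℕ.* suc k)         ≡⟨ sym (/ₙ-*-recip b (C-pos k<P) (s≤s z≤n)) ⟩
    (b /ₙ (P C suc k)) * recip (suc k)   ≡⟨ ℚₚ.*-comm (b /ₙ (P C suc k)) (recip (suc k)) ⟩
    recip (suc k) * (b /ₙ (P C suc k))   ∎
    where
    open ≡-Reasoning
    denominators : (P C k) ℕ.* (P ∸ k) ≡ (P C suc k) ℕ.* suc k
    denominators = trans (ℕₚ.*-comm (P C k) (P ∸ k))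
                         (trans (sym (C-step P k)) (ℕₚ.*-comm (suc k) (P C suc k)))

  Σ≥-K₀ : ∀ (w : ℕ → ℚ) {n} → 1 ≤ n → n ≤ P →
    recip (N ∸ n) * Σ≥ (K₀ ⊛ w) n ≡ (K₀ ⊛ (λ m → recip (N ∸ m) * w m)) n
  Σ≥-K₀ w {n@(suc k)} _ n≤P = begin
    recip (P ∸ k) * (∑[ n′ ∈ range N ] [ k <ᵇ n′ ]· (K₀ ⊛ w) n′)
      ≡⟨ cong (recip (P ∸ k) *_) (guarded-∑-⊛ K₀ (k <ᵇ_) w) ⟩
    recip (P ∸ k) * (∑[ m ∈ range N ] (∑[ n′ ∈ range N ] [ k <ᵇ n′ ]· K₀ n′ m) * w m)
      ≡⟨ sym (∑-*ˡ (range N) (recip (P ∸ k)) _) ⟩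
    ∑[ m ∈ range N ] recip (P ∸ k) * ((∑[ n′ ∈ range N ] [ k <ᵇ n′ ]· K₀ n′ m) * w m)
      ≡⟨ ∑-range-cong P pointwise ⟩
    ∑[ m ∈ range N ] recip n * (K₁ n m * w m)
      ≡⟨ ∑-*ˡ (range N) (recip n) (λ m → K₁ n m * w m) ⟩
    recip n * (K₁ ⊛ w) n
      ≡⟨ sym (K₀-⊛-recip w n) ⟩
    (K₀ ⊛ (λ m → recip (N ∸ m) * w m)) n ∎
    where
    open ≡-Reasoning
    pointwise : ∀ m → 1 ≤ m → m ≤ P →
      recip (P ∸ k) * ((∑[ n′ ∈ range N ] [ k <ᵇ n′ ]· K₀ n′ m) * w m) ≡ recip n * (K₁ n m * w m)
    pointwise m 1≤m m≤P = begin
      recip (P ∸ k) * ((∑[ n′ ∈ range N ] [ k <ᵇ n′ ]· K₀ n′ m) * w m)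
        ≡⟨ cong (λ t → recip (P ∸ k) * (t * w m)) (K₀-tail-sum (ℕₚ.<⇒≤ n≤P) 1≤m m≤P) ⟩
      recip (P ∸ k) * ((((m ∸ 1) C k) /ₙ (P C k)) * w m)
        ≡⟨ sym (ℚₚ.*-assoc (recip (P ∸ k)) (((m ∸ 1) C k) /ₙ (P C k)) (w m)) ⟩
      recip (P ∸ k) * (((m ∸ 1) C k) /ₙ (P C k)) * w m
        ≡⟨ cong (_* w m) (C-step-/ₙ ((m ∸ 1) C k) n≤P) ⟩
      recip n * K₁ n m * w m
        ≡⟨ ℚₚ.*-assoc (recip n) (K₁ n m) (w m) ⟩
      recip n * (K₁ n m * w m) ∎

  ∑-K₀ : ∀ (u : ℕ → ℚ) → ∑ (range N) (K₀ ⊛ u) ≡ ∑ (range N) u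
  ∑-K₀ u = begin
    ∑ (range N) (K₀ ⊛ u)
      ≡⟨ ∑-range-cong P (λ { (suc _) _ _ → refl }) ⟩
    ∑[ n ∈ range N ] [ 0 <ᵇ n ]· (K₀ ⊛ u) n
      ≡⟨ guarded-∑-⊛ K₀ (0 <ᵇ_) u ⟩
    ∑[ m ∈ range N ] (∑[ n ∈ range N ] [ 0 <ᵇ n ]· K₀ n m) * u m
      ≡⟨ ∑-range-cong P (λ m 1≤m m≤P →
           trans (cong (_* u m) (K₀-tail-sum z≤n 1≤m m≤P)) (ℚₚ.*-identityˡ (u m))) ⟩
    ∑ (range N) u ∎
    where open ≡-Reasoning

  K₁-chainSum : ∀ j g {x} → 1 ≤ x → x ≤ P →
    (K₁ ⊛ chainSum j g) x ≡ recip (x ^ j) * (K₁ ⊛ g) x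
  K₁-chainSum zero    g _ _ = sym (ℚₚ.*-identityˡ _)
  K₁-chainSum (suc j) g {x@(suc _)} 1≤x x≤P = begin
    (K₁ ⊛ Σ≥ (λ y → recip y * chainSum j g y)) x
      ≡⟨ sym (recip-K₁ (chainSum j g) 1≤x x≤P) ⟩
    recip x * (K₁ ⊛ chainSum j g) x
      ≡⟨ cong (recip x *_) (K₁-chainSum j g 1≤x x≤P) ⟩
    recip x * (recip (x ^ j) * (K₁ ⊛ g) x)
      ≡⟨ sym (ℚₚ.*-assoc (recip x) (recip (x ^ j)) ((K₁ ⊛ g) x)) ⟩
    recip x * recip (x ^ j) * (K₁ ⊛ g) x
      ≡⟨ cong (_* (K₁ ⊛ g) x) (sym (recip-* 1≤x (ℕₚ.m^n>0 x j))) ⟩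
    recip (x ^ suc j) * (K₁ ⊛ g) x ∎
    where open ≡-Reasoning

  recip-pow-K₁ : ∀ j g {x} → 1 ≤ x → x ≤ P →
    recip (x ^ suc j) * (K₁ ⊛ g) x ≡ (K₀ ⊛ (λ m → recip (N ∸ m) * chainSum j g m)) x
  recip-pow-K₁ j g {x} 1≤x x≤P = begin
    recip (x ^ suc j) * (K₁ ⊛ g) x                   ≡⟨ sym (K₁-chainSum (suc j) g 1≤x x≤P) ⟩
    (K₁ ⊛ chainSum (suc j) g) x                      ≡⟨ sym (recip-K₁ (chainSum j g) 1≤x x≤P) ⟩
    recip x * (K₁ ⊛ chainSum j g) x                  ≡⟨ sym (K₀-⊛-recip (chainSum j g) x) ⟩
    (K₀ ⊛ (λ m → recip (N ∸ m) * chainSum j g m)) x  ∎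
    where open ≡-Reasoning

  Σ>-Σ≥-K₀ : ∀ (u : ℕ → ℚ) {x} → 1 ≤ x → x ≤ P →
    recip (x ^ 1) * Σ> (K₀ ⊛ u) x + recip (N ∸ x) * Σ≥ (K₀ ⊛ u) x
      ≡ (K₀ ⊛ (λ m → recip (N ∸ m) * Σ≥ u m)) x
  Σ>-Σ≥-K₀ u {x} 1≤x x≤P = begin
    recip (x ^ 1) * Σ> (K₀ ⊛ u) x + recip (N ∸ x) * Σ≥ (K₀ ⊛ u) x
      ≡⟨ cong₂ _+_ (cong (recip (x ^ 1) *_) (Σ>-K₀ u 1≤x x≤P)) (Σ≥-K₀ u 1≤x x≤P) ⟩
    recip (x ^ 1) * (K₁ ⊛ Σ> u) x + (K₀ ⊛ (λ m → recip (N ∸ m) * u m)) x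
      ≡⟨ cong (_+ (K₀ ⊛ (λ m → recip (N ∸ m) * u m)) x) (recip-pow-K₁ 0 (Σ> u) 1≤x x≤P) ⟩
    (K₀ ⊛ (λ m → recip (N ∸ m) * Σ> u m)) x + (K₀ ⊛ (λ m → recip (N ∸ m) * u m)) x
      ≡⟨ sym (⊛-+ K₀ (λ m → recip (N ∸ m) * Σ> u m) (λ m → recip (N ∸ m) * u m) x) ⟩
    (K₀ ⊛ (λ m → recip (N ∸ m) * Σ> u m + recip (N ∸ m) * u m)) x
      ≡⟨ ⊛-cong K₀ x merge ⟩
    (K₀ ⊛ (λ m → recip (N ∸ m) * Σ≥ u m)) x ∎
    where
    open ≡-Reasoning
    merge : ∀ m → 1 ≤ m → m ≤ P →
      recip (N ∸ m) * Σ> u m + recip (N ∸ m) * u m ≡ recip (N ∸ m) * Σ≥ u m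
    merge m 1≤m m≤P = trans (sym (ℚₚ.*-distribˡ-+ (recip (N ∸ m)) (Σ> u m) (u m)))
      (cong (recip (N ∸ m) *_) (trans (ℚₚ.+-comm (Σ> u m) (u m)) (sym (∑-range-split P u 1≤m m≤P))))

module Recursions (P : ℕ) where

  open FiniteSums
  open Connector P
  open import Data.Bool using (Bool; true; if_then_else_)
  open import Data.List using ([]; _∷_)
  import Data.List.Properties as Listₚ
  open import Data.List.Relation.Unary.All using ([]; _∷_)
  open import Data.Nat using (zero; s≤s; _≤ᵇ_; _<ᵇ_; _≡ᵇ_; _∸_; _^_; pred)
  open import Data.Product using (_,_)
  open import Data.Rational using (ℚ; 0ℚ; 1ℚ; _+_; _*_)
  import Data.Rational.Properties as ℚₚ
  open import Relation.Binary.PropositionalEquality using (refl; sym; cong; cong₂)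

  link : ℕ → ℕ → ℕ → Bool
  link k y z = if k ≡ᵇ 1 then y ≤ᵇ z else y <ᵇ z

  -- c constrains the first summation variable; the two terms of ζ♢-summand are the cases 1 ∉ A
  -- and 1 ∈ A in the definition of ζ♢.
  mutual
    ζ♢-rec : List ℕ → (ℕ → Bool) → ℚ
    ζ♢-rec []       c = 1ℚ
    ζ♢-rec (k ∷ ks) c = ∑[ x ∈ range N ] [ c x ]· ζ♢-summand k ks x

    ζ♢-summand : ℕ → List ℕ → ℕ → ℚ
    ζ♢-summand k ks x =
      recip (x ^ k) * ζ♢-rec ks (x <ᵇ_) + [ k ≡ᵇ 1 ]· (recip (N ∸ x) * ζ♢-rec ks (x ≤ᵇ_))

  mutual
    rhs-rec : List ℕ → (ℕ → Bool) → ℚ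
    rhs-rec []       c = 1ℚ
    rhs-rec (k ∷ ks) c = ∑[ x ∈ range N ] [ c x ]· rhs-summand k ks x

    rhs-summand : ℕ → List ℕ → ℕ → ℚ
    rhs-summand k ks x = recip (N ∸ x) * chainSum (pred k) (λ y → rhs-rec ks (link k y)) x

  Admissible-∷ : ∀ {k k′ ks} → Admissible (k ∷ k′ ∷ ks) → Admissible (k′ ∷ ks)
  Admissible-∷ ([]       , m , eq , 2≤m) with () ← Listₚ.∷-injectiveʳ eq
  Admissible-∷ (_ ∷ ks₀ , m , eq , 2≤m) = ks₀ , m , Listₚ.∷-injectiveʳ eq , 2≤m

  Admissible-[_] : ∀ {k} → Admissible (k ∷ []) → 2 ≤ k
  Admissible-[_] ([]         , m , refl , 2≤m) = 2≤m
  Admissible-[_] (_ ∷ []     , m , () , _)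
  Admissible-[_] (_ ∷ _ ∷ _ , m , () , _)

  connector-identity : ∀ k ks → 1 ≤ k → All (1 ≤_) ks → Admissible (k ∷ ks) →
    ∀ x → 1 ≤ x → x ≤ P → ζ♢-summand k ks x ≡ (K₀ ⊛ rhs-summand k ks) x
  connector-identity (suc zero) [] _ _ adm with s≤s () ← Admissible-[ adm ]
  connector-identity k@(suc (suc j)) [] _ _ _ x 1≤x x≤P = begin
    recip (x ^ k) * 1ℚ + 0ℚ              ≡⟨ ℚₚ.+-identityʳ _ ⟩
    recip (x ^ k) * 1ℚ                   ≡⟨ cong (recip (x ^ k) *_) (sym (K₁-⊛-1 1≤x x≤P)) ⟩
    recip (x ^ k) * (K₁ ⊛ (λ _ → 1ℚ)) x  ≡⟨ recip-pow-K₁ (suc j) (λ _ → 1ℚ) 1≤x x≤P ⟩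
    (K₀ ⊛ rhs-summand k []) x            ∎
    where open ≡-Reasoning
  connector-identity (suc zero) (k′ ∷ ks) _ (1≤k′ ∷ 1≤ks) adm x 1≤x x≤P = begin
    recip (x ^ 1) * Σ> v x + recip (N ∸ x) * Σ≥ v x
      ≡⟨ cong₂ (λ s t → recip (x ^ 1) * s + recip (N ∸ x) * t)
               (∑-range-cong P (IH (x <ᵇ_))) (∑-range-cong P (IH (x ≤ᵇ_))) ⟩
    recip (x ^ 1) * Σ> (K₀ ⊛ u) x + recip (N ∸ x) * Σ≥ (K₀ ⊛ u) x
      ≡⟨ Σ>-Σ≥-K₀ u 1≤x x≤P ⟩
    (K₀ ⊛ rhs-summand 1 (k′ ∷ ks)) x ∎
    where
    open ≡-Reasoning
    v = ζ♢-summand k′ ks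
    u = rhs-summand k′ ks
    IH : ∀ (r : ℕ → Bool) y → 1 ≤ y → y ≤ P → [ r y ]· v y ≡ [ r y ]· (K₀ ⊛ u) y
    IH r y 1≤y y≤P = cong ([ r y ]·_) (connector-identity k′ ks 1≤k′ 1≤ks (Admissible-∷ adm) y 1≤y y≤P)
  connector-identity k@(suc (suc j)) (k′ ∷ ks) _ (1≤k′ ∷ 1≤ks) adm x 1≤x x≤P = begin
    recip (x ^ k) * Σ> v x + 0ℚ          ≡⟨ ℚₚ.+-identityʳ _ ⟩
    recip (x ^ k) * Σ> v x               ≡⟨ cong (recip (x ^ k) *_) (∑-range-cong P (IH (x <ᵇ_))) ⟩
    recip (x ^ k) * Σ> (K₀ ⊛ u) x        ≡⟨ cong (recip (x ^ k) *_) (Σ>-K₀ u 1≤x x≤P) ⟩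
    recip (x ^ k) * (K₁ ⊛ Σ> u) x        ≡⟨ recip-pow-K₁ (suc j) (Σ> u) 1≤x x≤P ⟩
    (K₀ ⊛ rhs-summand k (k′ ∷ ks)) x     ∎
    where
    open ≡-Reasoning
    v = ζ♢-summand k′ ks
    u = rhs-summand k′ ks
    IH : ∀ (r : ℕ → Bool) y → 1 ≤ y → y ≤ P → [ r y ]· v y ≡ [ r y ]· (K₀ ⊛ u) y
    IH r y 1≤y y≤P = cong ([ r y ]·_) (connector-identity k′ ks 1≤k′ 1≤ks (Admissible-∷ adm) y 1≤y y≤P)

  ζ♢-rec≡rhs-rec : ∀ k → All (1 ≤_) k → Admissible k →
    ζ♢-rec k (λ _ → true) ≡ rhs-rec k (λ _ → true)
  ζ♢-rec≡rhs-rec []       _ ([]    , _ , () , _)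
  ζ♢-rec≡rhs-rec []       _ (_ ∷ _ , _ , () , _)
  ζ♢-rec≡rhs-rec (k ∷ ks) (1≤k ∷ 1≤ks) adm = begin
    ∑ (range N) (ζ♢-summand k ks)              ≡⟨ ∑-range-cong P (connector-identity k ks 1≤k 1≤ks adm) ⟩
    ∑ (range N) (K₀ ⊛ rhs-summand k ks)        ≡⟨ ∑-K₀ (rhs-summand k ks) ⟩
    ∑ (range N) (rhs-summand k ks)             ∎
    where open ≡-Reasoning

module Enumerations (P : ℕ) where

  open FiniteSums
  open Connector P
  open Recursions P
  open import Data.Bool using (Bool; true; false; if_then_else_; _∧_; _≟_)
  import Data.Bool.Properties as Boolₚ
  open import Algebra.Solver.CommutativeMonoid Boolₚ.∧-commutativeMonoid using (solve; _⊕_; _⊜_)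
  open import Data.List as List using ([]; _∷_; _++_; map; concatMap)
  open import Data.List.Relation.Unary.All as All using ([]; _∷_)
  import Data.List.Relation.Unary.All.Properties as Allₚ
  open import Data.Nat using (zero; _≤ᵇ_; _<ᵇ_; _≡ᵇ_; _∸_; _^_)
  open import Data.Rational using (ℚ; _+_; _*_)
  import Data.Rational.Properties as ℚₚ
  open import Relation.Binary.PropositionalEquality using (refl; sym; trans; cong; cong₂)

  private variable
    A B : Set

  headSatisfies : (A → Bool) → List A → Bool
  headSatisfies p []      = true
  headSatisfies p (x ∷ _) = p x

  ∧-headSatisfies-true : ∀ b (xs : List A) → b ∧ headSatisfies (λ _ → true) xs ≡ b
  ∧-headSatisfies-true b []      = Boolₚ.∧-identityʳ b
  ∧-headSatisfies-true b (_ ∷ _) = Boolₚ.∧-identityʳ b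

  all-concatMap : ∀ {Q : B → Set} {f : A → List B} →
    (∀ x → All Q (f x)) → ∀ xs → All Q (concatMap f xs)
  all-concatMap Qf xs = Allₚ.concat⁺ (Allₚ.map⁺ (All.universal Qf xs))

  tuples-length : ∀ m → All (λ ns → List.length ns ≡ m) (tuples N m)
  tuples-length zero    = refl ∷ []
  tuples-length (suc m) =
    all-concatMap (λ _ → Allₚ.map⁺ (All.map (cong suc) (tuples-length m))) (range N)

  subsets1-length : ∀ ks → All (λ A → List.length A ≡ length ks) (subsets1 ks)
  subsets1-length []       = refl ∷ []
  subsets1-length (k ∷ ks) with k ≡ᵇ 1
  ... | true  = Allₚ.++⁺ (prefixed false) (prefixed true)
    where
    prefixed : ∀ a → All (λ A → List.length A ≡ suc (length ks)) (map (a ∷_) (subsets1 ks))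
    prefixed a = Allₚ.map⁺ (All.map (cong suc) (subsets1-length ks))
  ... | false = Allₚ.++⁺ (Allₚ.map⁺ (All.map (cong suc) (subsets1-length ks))) []

  blocks-length : ∀ ks → All (λ bs → List.length bs ≡ length ks) (blocks N ks)
  blocks-length []       = refl ∷ []
  blocks-length (k ∷ ks) =
    all-concatMap (λ _ → Allₚ.map⁺ (All.map (cong suc) (blocks-length ks))) (tuples N k)

  ∑-tuples-suc : ∀ m (F : List ℕ → ℚ) →
    ∑ (tuples N (suc m)) F ≡ ∑[ x ∈ range N ] ∑[ ns ∈ tuples N m ] F (x ∷ ns)
  ∑-tuples-suc m F = trans (∑-concatMap (range N) (λ x → map (x ∷_) (tuples N m)) F)
                           (∑-cong (range N) λ x → ∑-map (tuples N m) (x ∷_) F)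

  ∑-blocks-∷ : ∀ k ks (F : List (List ℕ) → ℚ) →
    ∑ (blocks N (k ∷ ks)) F ≡ ∑[ b ∈ tuples N k ] ∑[ bs ∈ blocks N ks ] F (b ∷ bs)
  ∑-blocks-∷ k ks F = trans (∑-concatMap (tuples N k) (λ b → map (b ∷_) (blocks N ks)) F)
                            (∑-cong (tuples N k) λ b → ∑-map (blocks N ks) (b ∷_) F)

  inS-∷ : ∀ a x (as : List Bool) (ns : List ℕ) → List.length as ≡ List.length ns →
    inS (a ∷ as) (x ∷ ns) ≡ headSatisfies (λ y → if a then x ≤ᵇ y else x <ᵇ y) ns ∧ inS as ns
  inS-∷ a x []       []      _  = refl
  inS-∷ a x (_ ∷ _) (_ ∷ _) _  = refl

  firstBlockSatisfies : (ℕ → Bool) → List (List ℕ) → Bool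
  firstBlockSatisfies c = headSatisfies (λ b → c (firstOf b))

  between-∷ : ∀ k ks b (bs : List (List ℕ)) → List.length bs ≡ length ks →
    between (k ∷ ks) (b ∷ bs) ≡ firstBlockSatisfies (link k (lastOf b)) bs ∧ between ks bs
  between-∷ k []      b []      _ = refl
  between-∷ k (_ ∷ _) b (_ ∷ _) _ = refl

  ζ♢-on : List ℕ → (ℕ → Bool) → List Bool → ℚ
  ζ♢-on ks c A = ∑[ ns ∈ tuples N (length ks) ] [ inS A ns ∧ headSatisfies c ns ]· termS N ks A ns

  ζ♢-restricted : List ℕ → (ℕ → Bool) → ℚ
  ζ♢-restricted ks c = ∑[ A ∈ subsets1 ks ] ζ♢-on ks c A

  module _ (k : ℕ) (ks : List ℕ) (a : Bool) where

    weight : ℕ → ℚ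
    weight x = if a then recip (N ∸ x) else recip (x ^ k)

    after : ℕ → ℕ → Bool
    after x y = if a then x ≤ᵇ y else x <ᵇ y

    ζ♢-on-∷ : ∀ c (A : List Bool) → List.length A ≡ length ks →
      ζ♢-on (k ∷ ks) c (a ∷ A) ≡ ∑[ x ∈ range N ] [ c x ]· (weight x * ζ♢-on ks (after x) A)
    ζ♢-on-∷ c A |A| = begin
      ζ♢-on (k ∷ ks) c (a ∷ A)
        ≡⟨ ∑-tuples-suc (length ks) _ ⟩
      ∑[ x ∈ range N ] ∑[ ns ∈ T ] [ inS (a ∷ A) (x ∷ ns) ∧ c x ]· (weight x * termS N ks A ns)
        ≡⟨ ∑-cong (range N) (λ x → ∑-congᴬ (All.map (reshuffle x) (tuples-length (length ks)))) ⟩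
      ∑[ x ∈ range N ] ∑[ ns ∈ T ] [ c x ]· (weight x * [ restriction x ns ]· termS N ks A ns)
        ≡⟨ ∑-cong (range N) (λ x → ∑-guarded-*ˡ (c x) T (weight x) _) ⟩
      ∑[ x ∈ range N ] [ c x ]· (weight x * ζ♢-on ks (after x) A) ∎
      where
      open ≡-Reasoning
      T = tuples N (length ks)
      restriction : ℕ → List ℕ → Bool
      restriction x ns = inS A ns ∧ headSatisfies (after x) ns
      reshuffle : ∀ x {ns} → List.length ns ≡ length ks →
        [ inS (a ∷ A) (x ∷ ns) ∧ c x ]· (weight x * termS N ks A ns)
          ≡ [ c x ]· (weight x * [ restriction x ns ]· termS N ks A ns)
      reshuffle x {ns} |ns| = trans (cong (λ t → [ t ]· (weight x * termS N ks A ns)) guards)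
                                    ([]·-∧-*ʳ (c x) (restriction x ns) (weight x) (termS N ks A ns))
        where
        guards : inS (a ∷ A) (x ∷ ns) ∧ c x ≡ c x ∧ restriction x ns
        guards = trans (cong (_∧ c x) (inS-∷ a x A ns (trans |A| (sym |ns|))))
          (solve 3 (λ h i cx → (h ⊕ i) ⊕ cx ⊜ cx ⊕ (i ⊕ h)) refl
             (headSatisfies (after x) ns) (inS A ns) (c x))

    ζ♢-restricted-∷ : (∀ c → ζ♢-restricted ks c ≡ ζ♢-rec ks c) → ∀ c →
      ∑[ A ∈ subsets1 ks ] ζ♢-on (k ∷ ks) c (a ∷ A)
        ≡ ∑[ x ∈ range N ] [ c x ]· (weight x * ζ♢-rec ks (after x))
    ζ♢-restricted-∷ IH c = begin
      ∑[ A ∈ S ] ζ♢-on (k ∷ ks) c (a ∷ A)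
        ≡⟨ ∑-congᴬ (All.map (λ {A} → ζ♢-on-∷ c A) (subsets1-length ks)) ⟩
      ∑[ A ∈ S ] ∑[ x ∈ range N ] [ c x ]· (weight x * ζ♢-on ks (after x) A)
        ≡⟨ ∑-swap S (range N) _ ⟩
      ∑[ x ∈ range N ] ∑[ A ∈ S ] [ c x ]· (weight x * ζ♢-on ks (after x) A)
        ≡⟨ ∑-cong (range N) (λ x → trans (∑-guarded-*ˡ (c x) S (weight x) (ζ♢-on ks (after x)))
                                          (cong (λ z → [ c x ]· (weight x * z)) (IH (after x)))) ⟩
      ∑[ x ∈ range N ] [ c x ]· (weight x * ζ♢-rec ks (after x)) ∎
      where
      open ≡-Reasoning
      S = subsets1 ks

  ζ♢-restricted≡ζ♢-rec : ∀ ks c → ζ♢-restricted ks c ≡ ζ♢-rec ks c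
  ζ♢-restricted≡ζ♢-rec []       c = trans (ℚₚ.+-identityʳ _) (ℚₚ.+-identityʳ _)
  ζ♢-restricted≡ζ♢-rec (k ∷ ks) c = begin
    ∑ (map (false ∷_) S ++ (if k ≡ᵇ 1 then map (true ∷_) S else [])) G
      ≡⟨ ∑-++ (map (false ∷_) S) _ G ⟩
    ∑ (map (false ∷_) S) G + ∑ (if k ≡ᵇ 1 then map (true ∷_) S else []) G
      ≡⟨ cong₂ _+_ (∑-map S (false ∷_) G)
                   (trans (∑-if (k ≡ᵇ 1) (map (true ∷_) S) G)
                          (cong ([ k ≡ᵇ 1 ]·_) (∑-map S (true ∷_) G))) ⟩
    (∑[ A ∈ S ] G (false ∷ A)) + [ k ≡ᵇ 1 ]· (∑[ A ∈ S ] G (true ∷ A))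
      ≡⟨ cong₂ (λ l r → l + [ k ≡ᵇ 1 ]· r) (ζ♢-restricted-∷ k ks false IH c)
                                            (ζ♢-restricted-∷ k ks true IH c) ⟩
    (∑[ x ∈ range N ] [ c x ]· α x) + [ k ≡ᵇ 1 ]· (∑[ x ∈ range N ] [ c x ]· β x)
      ≡⟨ cong ((∑[ x ∈ range N ] [ c x ]· α x) +_) ([]·-∑ (k ≡ᵇ 1) (range N) (λ x → [ c x ]· β x)) ⟩
    (∑[ x ∈ range N ] [ c x ]· α x) + (∑[ x ∈ range N ] [ k ≡ᵇ 1 ]· [ c x ]· β x)
      ≡⟨ sym (∑-+ (range N) (λ x → [ c x ]· α x) (λ x → [ k ≡ᵇ 1 ]· [ c x ]· β x)) ⟩
    ∑[ x ∈ range N ] ([ c x ]· α x + [ k ≡ᵇ 1 ]· [ c x ]· β x)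
      ≡⟨ ∑-cong (range N) (λ x → trans (cong ([ c x ]· α x +_) ([]·-comm (k ≡ᵇ 1) (c x) (β x)))
                                        (sym ([]·-+ (c x) (α x) ([ k ≡ᵇ 1 ]· β x)))) ⟩
    ∑[ x ∈ range N ] [ c x ]· ζ♢-summand k ks x ∎
    where
    open ≡-Reasoning
    S = subsets1 ks
    G = ζ♢-on (k ∷ ks) c
    IH = ζ♢-restricted≡ζ♢-rec ks
    α β : ℕ → ℚ
    α x = recip (x ^ k) * ζ♢-rec ks (x <ᵇ_)
    β x = recip (N ∸ x) * ζ♢-rec ks (x ≤ᵇ_)

  ζ♢≡ζ♢-rec : ∀ k → ζ♢ N k ≡ ζ♢-rec k (λ _ → true)
  ζ♢≡ζ♢-rec k = begin
    ζ♢ N k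
      ≡⟨ sumℚ-concatMap (subsets1 k) _ ⟩
    ∑[ A ∈ subsets1 k ] ∑ (List.filter (λ ns → inS A ns ≟ true) T) (termS N k A)
      ≡⟨ ∑-cong (subsets1 k) (λ A → trans (∑-filter T (inS A) (termS N k A)) (∑-cong T λ ns →
           cong (λ g → [ g ]· termS N k A ns) (sym (∧-headSatisfies-true (inS A ns) ns)))) ⟩
    ζ♢-restricted k (λ _ → true)
      ≡⟨ ζ♢-restricted≡ζ♢-rec k (λ _ → true) ⟩
    ζ♢-rec k (λ _ → true) ∎
    where
    open ≡-Reasoning
    T = tuples N (length k)

  chainTerm : (ℕ → ℚ) → ℕ → List ℕ → ℚ
  chainTerm g x ns = prodℚ (map recip ns) * g (lastOf (x ∷ ns))

  ∑-tuples-chainSum : ∀ j g x →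
    ∑[ ns ∈ tuples N j ] [ nondecr (x ∷ ns) ]· chainTerm g x ns ≡ chainSum j g x
  ∑-tuples-chainSum zero    g x = trans (ℚₚ.+-identityʳ _) (ℚₚ.*-identityˡ (g x))
  ∑-tuples-chainSum (suc j) g x = begin
    ∑[ ns ∈ tuples N (suc j) ] [ nondecr (x ∷ ns) ]· chainTerm g x ns
      ≡⟨ ∑-tuples-suc j _ ⟩
    ∑[ y ∈ range N ] ∑[ ns ∈ T ] [ (x ≤ᵇ y) ∧ nondecr (y ∷ ns) ]· chainTerm g x (y ∷ ns)
      ≡⟨ ∑-cong (range N) (λ y → ∑-cong T λ ns →
           []·-∧-*-assoc (x ≤ᵇ y) _ (recip y) (prodℚ (map recip ns)) (g (lastOf (y ∷ ns)))) ⟩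
    ∑[ y ∈ range N ] ∑[ ns ∈ T ] [ x ≤ᵇ y ]· (recip y * [ nondecr (y ∷ ns) ]· chainTerm g y ns)
      ≡⟨ ∑-cong (range N) (λ y → trans (∑-guarded-*ˡ (x ≤ᵇ y) T (recip y) _)
                                        (cong (λ z → [ x ≤ᵇ y ]· (recip y * z)) (∑-tuples-chainSum j g y))) ⟩
    ∑[ y ∈ range N ] [ x ≤ᵇ y ]· (recip y * chainSum j g y) ∎
    where
    open ≡-Reasoning
    T = tuples N j

  ∑-block-chainSum : ∀ j g (c : ℕ → Bool) →
    ∑[ b ∈ tuples N (suc j) ] [ nondecr b ∧ c (firstOf b) ]· (blockTerm N b * g (lastOf b))
      ≡ ∑[ x ∈ range N ] [ c x ]· (recip (N ∸ x) * chainSum j g x)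
  ∑-block-chainSum j g c = begin
    ∑[ b ∈ tuples N (suc j) ] [ nondecr b ∧ c (firstOf b) ]· (blockTerm N b * g (lastOf b))
      ≡⟨ ∑-tuples-suc j _ ⟩
    ∑[ x ∈ range N ] ∑[ ns ∈ T ] [ nondecr (x ∷ ns) ∧ c x ]·
                                   (recip (N ∸ x) * prodℚ (map recip ns) * g (lastOf (x ∷ ns)))
      ≡⟨ ∑-cong (range N) (λ x → ∑-cong T λ ns →
           trans (cong (λ t → [ t ]· _) (Boolₚ.∧-comm (nondecr (x ∷ ns)) (c x)))
                 ([]·-∧-*-assoc (c x) _ (recip (N ∸ x)) (prodℚ (map recip ns)) (g (lastOf (x ∷ ns))))) ⟩
    ∑[ x ∈ range N ] ∑[ ns ∈ T ] [ c x ]· (recip (N ∸ x) * [ nondecr (x ∷ ns) ]· chainTerm g x ns)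
      ≡⟨ ∑-cong (range N) (λ x → trans (∑-guarded-*ˡ (c x) T (recip (N ∸ x)) _)
                                        (cong (λ z → [ c x ]· (recip (N ∸ x) * z)) (∑-tuples-chainSum j g x))) ⟩
    ∑[ x ∈ range N ] [ c x ]· (recip (N ∸ x) * chainSum j g x) ∎
    where
    open ≡-Reasoning
    T = tuples N j

  allNondecr : List (List ℕ) → Bool
  allNondecr = List.foldr (λ b acc → nondecr b ∧ acc) true

  blockProduct : List (List ℕ) → ℚ
  blockProduct bs = prodℚ (map (blockTerm N) bs)

  rhs-restricted : List ℕ → (ℕ → Bool) → ℚ
  rhs-restricted ks c =
    ∑[ bs ∈ blocks N ks ] [ admissibleFamily ks bs ∧ firstBlockSatisfies c bs ]· blockProduct bs

  rhs-restricted≡rhs-rec : ∀ ks → All (1 ≤_) ks → ∀ c → rhs-restricted ks c ≡ rhs-rec ks c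
  rhs-restricted≡rhs-rec []               _          c = ℚₚ.+-identityʳ _
  rhs-restricted≡rhs-rec (k@(suc j) ∷ ks) (_ ∷ 1≤ks) c = begin
    rhs-restricted (k ∷ ks) c
      ≡⟨ ∑-blocks-∷ k ks _ ⟩
    ∑[ b ∈ tuples N k ] ∑[ bs ∈ blocks N ks ]
      [ admissibleFamily (k ∷ ks) (b ∷ bs) ∧ c (firstOf b) ]· (blockTerm N b * blockProduct bs)
      ≡⟨ ∑-cong (tuples N k) (λ b → ∑-congᴬ (All.map (reshuffle b) (blocks-length ks))) ⟩
    ∑[ b ∈ tuples N k ] ∑[ bs ∈ blocks N ks ] [ first b ]· (blockTerm N b * [ rest b bs ]· blockProduct bs)
      ≡⟨ ∑-cong (tuples N k) (λ b → trans (∑-guarded-*ˡ (first b) (blocks N ks) (blockTerm N b) _)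
           (cong (λ z → [ first b ]· (blockTerm N b * z)) (rhs-restricted≡rhs-rec ks 1≤ks (link k (lastOf b))))) ⟩
    ∑[ b ∈ tuples N k ] [ first b ]· (blockTerm N b * rhs-rec ks (link k (lastOf b)))
      ≡⟨ ∑-block-chainSum j (λ y → rhs-rec ks (link k y)) c ⟩
    rhs-rec (k ∷ ks) c ∎
    where
    open ≡-Reasoning
    first : List ℕ → Bool
    first b = nondecr b ∧ c (firstOf b)
    rest : List ℕ → List (List ℕ) → Bool
    rest b bs = admissibleFamily ks bs ∧ firstBlockSatisfies (link k (lastOf b)) bs
    reshuffle : ∀ b {bs} → List.length bs ≡ length ks →
      [ admissibleFamily (k ∷ ks) (b ∷ bs) ∧ c (firstOf b) ]· (blockTerm N b * blockProduct bs)
        ≡ [ first b ]· (blockTerm N b * [ rest b bs ]· blockProduct bs)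
    reshuffle b {bs} |bs| = trans (cong (λ t → [ t ]· (blockTerm N b * blockProduct bs)) guards)
                                  ([]·-∧-*ʳ (first b) (rest b bs) (blockTerm N b) (blockProduct bs))
      where
      guards : admissibleFamily (k ∷ ks) (b ∷ bs) ∧ c (firstOf b) ≡ first b ∧ rest b bs
      guards = trans
        (cong (λ t → ((nondecr b ∧ allNondecr bs) ∧ t) ∧ c (firstOf b)) (between-∷ k ks b bs |bs|))
        (solve 5 (λ n f h w cb → ((n ⊕ f) ⊕ (h ⊕ w)) ⊕ cb ⊜ (n ⊕ cb) ⊕ ((f ⊕ w) ⊕ h)) refl
           (nondecr b) (allNondecr bs) (firstBlockSatisfies (link k (lastOf b)) bs) (between ks bs) (c (firstOf b)))

  rhs≡rhs-rec : ∀ k → All (1 ≤_) k → rhs N k ≡ rhs-rec k (λ _ → true)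
  rhs≡rhs-rec k 1≤k = begin
    rhs N k
      ≡⟨ ∑-filter (blocks N k) (admissibleFamily k) blockProduct ⟩
    ∑[ bs ∈ blocks N k ] [ admissibleFamily k bs ]· blockProduct bs
      ≡⟨ ∑-cong (blocks N k) (λ bs → cong (λ g → [ g ]· blockProduct bs)
           (sym (∧-headSatisfies-true (admissibleFamily k bs) bs))) ⟩
    rhs-restricted k (λ _ → true)
      ≡⟨ rhs-restricted≡rhs-rec k 1≤k (λ _ → true) ⟩
    rhs-rec k (λ _ → true) ∎
    where open ≡-Reasoning

corollary3p10 : (N : ℕ) → 1 ≤ N → (k : List ℕ) → All (λ x → 1 ≤ x) k →
    Admissible k → ζ♢ N k ≡ rhs N k
corollary3p10 (suc P) _ k 1≤k adm = begin
  ζ♢ (suc P) k            ≡⟨ ζ♢≡ζ♢-rec k ⟩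
  ζ♢-rec k (λ _ → true)   ≡⟨ ζ♢-rec≡rhs-rec k 1≤k adm ⟩
  rhs-rec k (λ _ → true)  ≡⟨ sym (rhs≡rhs-rec k 1≤k) ⟩
  rhs (suc P) k           ∎
  where
  open ≡-Reasoning
  open Recursions P
  open Enumerations P
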